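{- Let $A$ be an $m\times n$ integer matrix such that every row except possibly the first has its minimum attained at least twice (so at most the first row has a strict minimum). Run the lifting phase of Grigoriev's algorithm on $A$: while the first row has a strict minimum, perform a lifting (returning "infeasible" if lifting is impossible). Then Grigoriev's algorithm finds the componentwise smallest nonnegative solution of the system; equivalently, the matrix it outputs is the smallest solution matrix that is (componentwise) greater than or equal to $A$, i.e. it equals $A+x$ (adding $x_j$ to column $j$) where $x$ is the componentwise smallest vector with $x\ge 0$ that is a solution of $A$.
   Context: A tropical linear system is given by an $m\times n$ integer matrix $A=(a_{ij})$. A solution is a row $x=(x_1,\dots,x_n)$ such that for every row $i$ the minimum $\min_j(a_{ij}+x_j)$ is attained at least twice; a minimum attained at exactly one column is called a strict minimum. A solution matrix is a matrix obtained from $A$ by adding constants to columns (and rows) for which the zero row is a solution, i.e. no row has a strict minimum. Solutions are partially ordered componentwise. Lifting (Grigoriev): let $i$ be the column of the first row's strict minimum. Set $J=\{i\}$; while there is a row whose set of minimum positions contains exactly one column $j\notin J$, add $j$ to $J$ (the resulting set $J$ is the unique inclusion-maximal such set). If $|J|=n$, lifting is impossible. Otherwise let $a$ be the largest number that can be added to all columns indexed by $J$ such that in every row the minimal elements remain minimal (i.e. the minimum over rows whose minima lie only in $J$ of the gap between the row minimum and the smallest entry of that row outside $J$), and add $a$ to every column in $J$. -}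

module Defs where

open import Data.Nat using (ℕ; zero; suc)
open import Data.Integer using (ℤ; _+_; _-_; _≤_; _⊓_; _≤?_; 0ℤ)
open import Data.Integer.Properties using () renaming (_≟_ to _≟ℤ_)
open import Data.Fin using (Fin; zero; suc)
open import Data.Fin.Properties using () renaming (_≟_ to _≟F_)
open import Data.Bool using (Bool; true; false; if_then_else_; _∧_; _∨_; not)
open import Data.List using (List; []; _∷_; filter; map; foldr; allFin)
open import Data.Maybe using (Maybe; just; nothing)
open import Data.Product using (∃; _×_; Σ-syntax; ∃-syntax)
open import Relation.Nullary using (¬_; does)
open import Relation.Binary.PropositionalEquality using (_≡_; _≢_)

-- Matrices with m+1 rows (row `zero` is "the first row") and n+1 columns
-- (so that row minima exist).

Row : ℕ → Set
Row n = Fin (suc n) → ℤ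

Matrix : ℕ → ℕ → Set
Matrix m n = Fin (suc m) → Row n

IsMinAt : ∀ {n} → Row n → Fin (suc n) → Set
IsMinAt r j = ∀ k → r j ≤ r k

MinTwice : ∀ {n} → Row n → Set
MinTwice r = ∃[ j ] ∃[ k ] (j ≢ k × IsMinAt r j × IsMinAt r k)

addCols : ∀ {m n} → Matrix m n → (Fin (suc n) → ℤ) → Matrix m n
addCols A x i j = A i j + x j

IsSolution : ∀ {m n} → Matrix m n → (Fin (suc n) → ℤ) → Set
IsSolution A x = ∀ i → MinTwice (addCols A x i)

Nonneg : ∀ {n} → (Fin (suc n) → ℤ) → Set
Nonneg x = ∀ j → 0ℤ ≤ x j

IsLeastNonnegSolution : ∀ {m n} → Matrix m n → (Fin (suc n) → ℤ) → Set
IsLeastNonnegSolution A x =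
  Nonneg x × IsSolution A x ×
  (∀ y → Nonneg y → IsSolution A y → ∀ j → x j ≤ y j)

rowMin : ∀ {n} → Row n → ℤ
rowMin {zero}  r = r zero
rowMin {suc n} r = r zero ⊓ rowMin {n} (λ j → r (suc j))

minPos : ∀ {n} → Row n → List (Fin (suc n))
minPos r = filter (λ j → r j ≟ℤ rowMin r) (allFin _)

strictMinCol : ∀ {n} → Row n → Maybe (Fin (suc n))
strictMinCol r with minPos r
... | j ∷ [] = just j
... | _      = nothing

Subset : ℕ → Set
Subset n = Fin (suc n) → Bool

singleton : ∀ {n} → Fin (suc n) → Subset n
singleton i j = does (j ≟F i)

notIn : ∀ {n} → Subset n → List (Fin (suc n)) → List (Fin (suc n))
notIn J = filter (λ j → Relation.Nullary.Decidable.¬? (Data.Bool.Properties.T? (J j)))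
  where import Relation.Nullary.Decidable
        import Data.Bool.Properties

newCols : ∀ {m n} → Matrix m n → Subset n → Subset n
newCols {m} A J j = anyL (map test (allFin (suc m)))
  where
  anyL : List Bool → Bool
  anyL = foldr _∨_ false
  test : Fin (suc m) → Bool
  test i with notIn J (minPos (A i))
  ... | k ∷ [] = does (k ≟F j)
  ... | _      = false

closeStep : ∀ {m n} → Matrix m n → Subset n → Subset n
closeStep A J j = J j ∨ newCols A J j

iterate : ∀ {A : Set} → ℕ → (A → A) → A → A
iterate zero    f a = a
iterate (suc k) f a = iterate k f (f a)

-- The inclusion-maximal set J obtained from {i} by repeatedly adding a
-- column j ∉ J such that some row has exactly one minimum position
-- outside J, namely j.  Each non-stationary round adds a column, so
-- n+1 rounds reach the fixed point.
liftSet : ∀ {m n} → Matrix m n → Fin (suc n) → Subset n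
liftSet {n = n} A i = iterate (suc n) (closeStep A) (singleton i)

allIn : ∀ {n} → Subset n → Bool
allIn J = foldr _∧_ true (map J (allFin _))

minList : List ℤ → Maybe ℤ
minList []       = nothing
minList (x ∷ xs) with minList xs
... | nothing = just x
... | just y  = just (x ⊓ y)

fromMaybe0 : Maybe ℤ → ℤ
fromMaybe0 nothing  = 0ℤ
fromMaybe0 (just x) = x

minsInJ : ∀ {n} → Subset n → Row n → Bool
minsInJ J r = foldr _∧_ true (map J (minPos r))

-- gap between the row minimum and the smallest entry outside J
-- (J ≠ all columns when this is used, so the list is nonempty)
gap : ∀ {n} → Subset n → Row n → ℤ
gap J r = fromMaybe0 (minList (map r (notIn J (allFin _)))) - rowMin r

-- the lifting amount a (the list is nonempty: the first row qualifies)
liftAmount : ∀ {m n} → Matrix m n → Subset n → ℤ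
liftAmount {m} A J =
  fromMaybe0 (minList (map (λ i → gap J (A i))
                           (filter (λ i → Data.Bool.Properties.T? (minsInJ J (A i)))
                                   (allFin (suc m)))))
  where import Data.Bool.Properties

-- One lifting, with respect to the strict minimum of the first row at
-- column i.  `nothing` means lifting is impossible (|J| = n).
lift : ∀ {m n} → Matrix m n → Fin (suc n) → Maybe (Matrix m n)
lift A i with allIn (liftSet A i)
... | true  = nothing
... | false = just (λ r c → A r c + (if liftSet A i c then liftAmount A (liftSet A i) else 0ℤ))

data Outcome (m n : ℕ) : Set where
  infeasible : Outcome m n
  output     : Matrix m n → Outcome m n
  outOfFuel  : Outcome m n

-- Lifting phase run with at most k liftings: while the first row has a
-- strict minimum, lift (returning infeasible if lifting is impossible).
liftingPhase : ∀ {m n} → ℕ → Matrix m n → Outcome m n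
liftingPhase k A with strictMinCol (A zero)
liftingPhase k       A | nothing = output A
liftingPhase zero    A | just i  = outOfFuel
liftingPhase (suc k) A | just i with lift A i
... | nothing = infeasible
... | just A' = liftingPhase k A'

-- Every matrix met in the lifting phase is A + x (x added to the columns), and
-- the phase keeps x ≥ 0, keeps a double minimum in every row but the first, and
-- keeps x below every nonnegative solution of A.  The last point is Grigoriev's
-- observation that a nonnegative solution y of the current matrix B is ≥ a on the
-- lifting set F: otherwise y takes some value v < a on F while y ≥ v on F, and the
-- first column of F with y = v, in the order F was built, is a strict row minimum
-- of B + y, because in a row whose minima all lie in F every entry outside F
-- exceeds the minimum by at least a.  If F is all columns this works for every v,
-- so no nonnegative solution exists.  Each lifting strictly raises x, so below a
-- solution the phase must stop, and then no row of A + x has a strict minimum: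
-- x is the least nonnegative solution.

module Submission where

open import Defs
open import Data.Nat using (ℕ; suc)
open import Data.Fin using (Fin; zero; suc)
open import Data.Integer using (ℤ)
open import Data.Product using (_×_; ∃-syntax)
open import Relation.Nullary using (¬_)
open import Relation.Binary.PropositionalEquality using (_≡_)

import Data.Nat as ℕ
import Data.Nat.Properties as ℕ
open import Data.Integer using (_+_; _-_; -_; _≤_; _<_; 0ℤ; +_; ∣_∣; +≤+; +<+; nonNegative)
import Data.Integer.Properties as ℤ
open import Data.Integer.Tactic.RingSolver using (solve-∀)
open import Data.Fin.Properties using (_≟_; any?; ¬∀⟶∃¬)
import Data.Fin.Subset as Sub
import Data.Fin.Subset.Properties as Sub
open import Data.Bool using (true; false; T; if_then_else_)
open import Data.Bool.Properties using (T?; T-≡; T-∨)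
open import Data.List using (List; []; _∷_; allFin; map; filter)
open import Data.List.Membership.Propositional using (_∈_; lose; find)
open import Data.List.Membership.Propositional.Properties using (∈-filter⁺; ∈-filter⁻; ∈-allFin; ∈-map⁺)
open import Data.List.Properties using (filter-≐)
open import Data.List.Relation.Unary.All as All using (All)
import Data.List.Relation.Unary.All.Properties as All
open import Data.List.Relation.Unary.Any using (here; there; satisfied)
open import Data.List.Relation.Unary.Any.Properties using (any⁺; any⁻)
open import Data.List.Relation.Unary.AllPairs using (_∷_)
open import Data.List.Relation.Unary.Unique.Propositional using (Unique)
import Data.List.Relation.Unary.Unique.Propositional.Properties as Unique
open import Data.Maybe using (just; nothing)
open import Data.Product using (∃; _,_; proj₁; proj₂)
open import Data.Sum using (_⊎_; inj₁; inj₂; [_,_])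
open import Data.Empty using (⊥)
open import Data.Unit using (tt)
import Data.Vec as Vec
import Data.Vec.Properties as Vec
open import Function using (_∘_; id; Equivalence)
open import Relation.Nullary using (yes; no; contradiction)
open import Relation.Nullary.Decidable using (dec-true; decidable-stable; _×-dec_; ¬?)
open import Relation.Binary.PropositionalEquality using (refl; sym; trans; cong; cong₂; subst; subst₂; _≢_)

minList-≤ : ∀ {xs : List ℤ} {z} → z ∈ xs → fromMaybe0 (minList xs) ≤ z
minList-≤ {x ∷ xs} (here refl) with minList xs
... | nothing = ℤ.≤-refl
... | just w  = ℤ.i⊓j≤i x w
minList-≤ {x ∷ y ∷ xs} (there z∈) with minList xs | minList-≤ {y ∷ xs} z∈
... | nothing | y≤z = ℤ.≤-trans (ℤ.i⊓j≤j x y) y≤z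
... | just w  | m≤z = ℤ.≤-trans (ℤ.i⊓j≤j x _) m≤z

minList-greatest : ∀ {xs : List ℤ} {z c} → z ∈ xs → All (c ≤_) xs → c ≤ fromMaybe0 (minList xs)
minList-greatest {x ∷ []} _ (c≤x All.∷ All.[]) = c≤x
minList-greatest {x ∷ y ∷ xs} _ (c≤x All.∷ c≤ys) with minList xs | minList-greatest (here refl) c≤ys
... | nothing | c≤y = ℤ.⊓-glb c≤x c≤y
... | just w  | c≤m = ℤ.⊓-glb c≤x c≤m

module _ {n} (r : Row n) where

  rowMin-≤ : ∀ k → rowMin r ≤ r k
  rowMin-≤ = go r
    where
    go : ∀ {n} (r : Row n) k → rowMin r ≤ r k
    go {ℕ.zero} r zero    = ℤ.≤-refl
    go {suc n}  r zero    = ℤ.i⊓j≤i (r zero) _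
    go {suc n}  r (suc k) = ℤ.≤-trans (ℤ.i⊓j≤j (r zero) _) (go (r ∘ suc) k)

  rowMin-attained : ∃ λ k → r k ≡ rowMin r
  rowMin-attained = go r
    where
    go : ∀ {n} (r : Row n) → ∃ λ k → r k ≡ rowMin r
    go {ℕ.zero} r = zero , refl
    go {suc n}  r with ℤ.⊓-sel (r zero) (rowMin (r ∘ suc))
    ... | inj₁ r₀≡min = zero , sym r₀≡min
    ... | inj₂ min≡ = let k , rk≡ = go (r ∘ suc) in suc k , trans rk≡ (sym min≡)

  ∈-minPos⁺ : ∀ {k} → r k ≡ rowMin r → k ∈ minPos r
  ∈-minPos⁺ {k} = ∈-filter⁺ (λ j → r j ℤ.≟ rowMin r) (∈-allFin k)

  ∈-minPos⁻ : ∀ {k} → k ∈ minPos r → r k ≡ rowMin r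
  ∈-minPos⁻ = proj₂ ∘ ∈-filter⁻ (λ j → r j ℤ.≟ rowMin r)

  minPos-unique : Unique (minPos r)
  minPos-unique = Unique.filter⁺ (λ j → r j ℤ.≟ rowMin r) (Unique.allFin⁺ _)

  ≡rowMin⇒IsMinAt : ∀ {k} → r k ≡ rowMin r → IsMinAt r k
  ≡rowMin⇒IsMinAt rk≡min k′ = subst (_≤ r k′) (sym rk≡min) (rowMin-≤ k′)

  IsMinAt⇒≡rowMin : ∀ {k} → IsMinAt r k → r k ≡ rowMin r
  IsMinAt⇒≡rowMin {k} rk≤ =
    let k₀ , rk₀≡min = rowMin-attained
    in ℤ.≤-antisym (subst (r k ≤_) rk₀≡min (rk≤ k₀)) (rowMin-≤ k)

  strictMinCol≡just : ∀ {i} → strictMinCol r ≡ just i → minPos r ≡ i ∷ []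
  strictMinCol≡just eq with minPos r | eq
  ... | _ ∷ [] | refl = refl

  MinTwice-from-minPos : ∀ {l p q} → Unique (p ∷ q ∷ l) →
    (∀ {k} → k ∈ p ∷ q ∷ l → k ∈ minPos r) → MinTwice r
  MinTwice-from-minPos ((p≢q All.∷ _) ∷ _) ⊆minPos =
    _ , _ , p≢q , ≡rowMin⇒IsMinAt (∈-minPos⁻ (⊆minPos (here refl)))
                , ≡rowMin⇒IsMinAt (∈-minPos⁻ (⊆minPos (there (here refl))))

  strictMinCol≡nothing : strictMinCol r ≡ nothing → MinTwice r
  strictMinCol≡nothing eq with minPos r in minPos≡ | eq | minPos-unique
  ... | [] | _ | _ =
    let k , rk≡min = rowMin-attained in contradiction (subst (k ∈_) minPos≡ (∈-minPos⁺ rk≡min)) λ ()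
  ... | _ ∷ _ ∷ _ | _ | unique = MinTwice-from-minPos unique (subst (_ ∈_) (sym minPos≡))

  strictMin⇒¬MinTwice : ∀ j → (∀ k → k ≢ j → r j < r k) → ¬ MinTwice r
  strictMin⇒¬MinTwice j strict (p , q , p≢q , p-min , q-min) with p ≟ j
  ... | no p≢j    = ℤ.<⇒≱ (strict p p≢j) (p-min j)
  ... | yes refl  = ℤ.<⇒≱ (strict q (p≢q ∘ sym)) (q-min p)

MinTwice-cong : ∀ {n} {r s : Row n} → (∀ c → r c ≡ s c) → MinTwice r → MinTwice s
MinTwice-cong r≗s (p , q , p≢q , p-min , q-min) =
  p , q , p≢q , (λ k → subst₂ _≤_ (r≗s p) (r≗s k) (p-min k))
              , (λ k → subst₂ _≤_ (r≗s q) (r≗s k) (q-min k))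

_⊆_ : ∀ {n} → Subset n → Subset n → Set
J ⊆ J′ = ∀ j → T (J j) → T (J′ j)

module _ {n} (J : Subset n) where

  ∈-notIn⁺ : ∀ {l k} → k ∈ l → ¬ T (J k) → k ∈ notIn J l
  ∈-notIn⁺ = ∈-filter⁺ (¬? ∘ T? ∘ J)

  ∈-notIn⁻ : ∀ {l k} → k ∈ notIn J l → k ∈ l × ¬ T (J k)
  ∈-notIn⁻ = ∈-filter⁻ (¬? ∘ T? ∘ J)

  notIn-unique : ∀ {l} → Unique l → Unique (notIn J l)
  notIn-unique = Unique.filter⁺ (¬? ∘ T? ∘ J)

notIn-cong : ∀ {n} {J J′ : Subset n} → J ⊆ J′ → J′ ⊆ J → ∀ l → notIn J l ≡ notIn J′ l
notIn-cong {J = J} {J′} J⊆J′ J′⊆J =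
  filter-≐ (¬? ∘ T? ∘ J) (¬? ∘ T? ∘ J′) ((λ {j} → _∘ J′⊆J j) , (λ {j} → _∘ J⊆J′ j))

∈-singleton⁻ : ∀ {n} {i j : Fin (suc n)} → T (singleton i j) → j ≡ i
∈-singleton⁻ {i = i} {j} t with j ≟ i
... | yes j≡i = j≡i

size : ∀ {n} → Subset n → ℕ
size J = Sub.∣ Vec.tabulate J ∣

∈-tabulate⁺ : ∀ {n} {J : Subset n} {j} → T (J j) → j Sub.∈ Vec.tabulate J
∈-tabulate⁺ {J = J} {j} Jj = Vec.lookup⇒[]= j _ (trans (Vec.lookup∘tabulate J j) (Equivalence.to T-≡ Jj))

∈-tabulate⁻ : ∀ {n} {J : Subset n} {j} → j Sub.∈ Vec.tabulate J → T (J j)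
∈-tabulate⁻ {J = J} {j} j∈ = Equivalence.from T-≡ (trans (sym (Vec.lookup∘tabulate J j)) (Vec.[]=⇒lookup j∈))

size-≤ : ∀ {n} (J : Subset n) → size J ℕ.≤ suc n
size-≤ J = Sub.∣p∣≤n (Vec.tabulate J)

size-positive : ∀ {n} (J : Subset n) {j} → T (J j) → 0 ℕ.< size J
size-positive J Jj = ℕ.<-≤-trans (ℕ.s≤s ℕ.z≤n) (Sub.x∈p⇒∣p-x∣<∣p∣ (∈-tabulate⁺ {J = J} Jj))

size-grows : ∀ {n} {J J′ : Subset n} {j} → J ⊆ J′ → T (J′ j) → ¬ T (J j) → size J ℕ.< size J′
size-grows {J = J} {J′} J⊆J′ J′j ¬Jj = Sub.p⊂q⇒∣p∣<∣q∣
  ( (λ j∈ → ∈-tabulate⁺ {J = J′} (J⊆J′ _ (∈-tabulate⁻ {J = J} j∈)))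
  , _ , ∈-tabulate⁺ {J = J′} J′j , ¬Jj ∘ ∈-tabulate⁻ {J = J})

iterate-suc : ∀ {X : Set} k (f : X → X) x → iterate (suc k) f x ≡ f (iterate k f x)
iterate-suc ℕ.zero  f x = refl
iterate-suc (suc k) f x = iterate-suc k f (f x)

iterate-preserves : ∀ {X : Set} (P : X → Set) (f : X → X) → (∀ {x} → P x → P (f x)) →
  ∀ k x → P x → P (iterate k f x)
iterate-preserves P f step ℕ.zero  x Px = Px
iterate-preserves P f step (suc k) x Px = iterate-preserves P f step k (f x) (step Px)

-- The lifting set is the closure of {i} under closeStep

module Closure {m n} (B : Matrix m n) where

  -- `newCols` tests each row with an unnamed local function; `any⁻` and `any⁺`
  -- recover its instances by unification, and `with` then evaluates them.
  newCols⇒ : ∀ J j → T (newCols B J j) → ∃ λ r → notIn J (minPos (B r)) ≡ j ∷ []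
  newCols⇒ J j t with satisfied (any⁻ _ (allFin (suc m)) t)
  ... | r , test with notIn J (minPos (B r)) in eq | test
  ... | k ∷ [] | _ with k ≟ j
  ... | yes refl = r , eq

  private
    ¬¬newCols : ∀ J j r → notIn J (minPos (B r)) ≡ j ∷ [] → ¬ ¬ T (newCols B J j)
    ¬¬newCols J j r eq ¬new
      with notIn J (minPos (B r)) | eq | ¬new ∘ any⁺ {xs = allFin (suc m)} _ ∘ lose (∈-allFin r)
    ... | _ | refl | ¬test = ¬test (Equivalence.from T-≡ (dec-true (j ≟ j) refl))

  newCols⇐ : ∀ J j r → notIn J (minPos (B r)) ≡ j ∷ [] → T (newCols B J j)
  newCols⇐ J j r eq = decidable-stable (T? _) (¬¬newCols J j r eq)

  closeStep-⊇ : ∀ J → J ⊆ closeStep B J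
  closeStep-⊇ J j = Equivalence.from (T-∨ {J j}) ∘ inj₁

  closeStep⇒ : ∀ J j → T (closeStep B J j) → T (J j) ⊎ ∃ λ r → notIn J (minPos (B r)) ≡ j ∷ []
  closeStep⇒ J j t with Equivalence.to (T-∨ {J j}) t
  ... | inj₁ Jj  = inj₁ Jj
  ... | inj₂ new = inj₂ (newCols⇒ J j new)

  closeStep⇐ : ∀ J j r → notIn J (minPos (B r)) ≡ j ∷ [] → T (closeStep B J j)
  closeStep⇐ J j r eq = Equivalence.from (T-∨ {J j}) (inj₂ (newCols⇐ J j r eq))

  Closed : Subset n → Set
  Closed J = closeStep B J ⊆ J

  Closed-cong : ∀ {J J′} → J ⊆ J′ → J′ ⊆ J → Closed J → Closed J′
  Closed-cong {J} {J′} J⊆J′ J′⊆J closed j t with closeStep⇒ J′ j t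
  ... | inj₁ J′j = J′j
  ... | inj₂ (r , eq) =
    J⊆J′ j (closed j (closeStep⇐ J j r (trans (notIn-cong J⊆J′ J′⊆J (minPos (B r))) eq)))

  closed-or-grows : ∀ J → Closed J ⊎ ∃ λ j → T (closeStep B J j) × ¬ T (J j)
  closed-or-grows J with any? (λ j → T? (closeStep B J j) ×-dec ¬? (T? (J j)))
  ... | yes grows  = inj₂ grows
  ... | no ¬grows = inj₁ λ j t → decidable-stable (T? (J j)) (λ ¬Jj → ¬grows (j , t , ¬Jj))

  module _ (i : Fin (suc n)) where

    private
      F : Subset n
      F = liftSet B i

      stage : ℕ → Subset n
      stage t = iterate t (closeStep B) (singleton i)

    ∋-singleton : T (singleton {n} i i)
    ∋-singleton = Equivalence.from (T-≡ {singleton i i}) (dec-true (i ≟ i) refl)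

    liftSet-∋ : T (F i)
    liftSet-∋ =
      iterate-preserves (λ J → T (J i)) (closeStep B) (λ {J} → closeStep-⊇ J i) (suc n) (singleton i) ∋-singleton

    stage-closed-or-large : ∀ t → Closed (stage t) ⊎ t ℕ.< size (stage t)
    stage-closed-or-large ℕ.zero = inj₂ (size-positive (singleton i) {i} ∋-singleton)
    stage-closed-or-large (suc t) rewrite iterate-suc t (closeStep B) (singleton i)
      with closed-or-grows (stage t) | stage-closed-or-large t
    ... | inj₁ closed | _ = inj₁ (Closed-cong (closeStep-⊇ _) closed closed)
    ... | inj₂ (j , t′ , ¬j) | inj₁ closed = contradiction (closed j t′) ¬j
    ... | inj₂ (j , t′ , ¬j) | inj₂ large  =
      inj₂ (ℕ.≤-<-trans large (size-grows {J = stage t} (closeStep-⊇ _) t′ ¬j))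

    liftSet-closed : Closed F
    liftSet-closed with stage-closed-or-large (suc n)
    ... | inj₁ closed = closed
    ... | inj₂ large  = contradiction (size-≤ F) (ℕ.<⇒≱ large)

    liftSet-ind : (P : Subset n → Set) → P (singleton i) →
      (∀ J → J ⊆ F → closeStep B J ⊆ F → P J → P (closeStep B J)) → P F
    liftSet-ind P base step =
      iterate-preserves (λ J → J ⊆ F → P J) (closeStep B) step′ (suc n) (singleton i) (λ _ → base) (λ _ → id)
      where
      step′ : ∀ {J} → (J ⊆ F → P J) → closeStep B J ⊆ F → P (closeStep B J)
      step′ {J} P′J cJ⊆F = step J J⊆F cJ⊆F (P′J J⊆F)
        where J⊆F = λ j → cJ⊆F j ∘ closeStep-⊇ J j

i+[j-i]≡j : ∀ i j → i + (j - i) ≡ j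
i+[j-i]≡j = solve-∀

i<j⇒1≤j-i : ∀ {i j} → i < j → + 1 ≤ j - i
i<j⇒1≤j-i {i} {j} i<j = subst (_≤ j - i) (1+i-i≡1 i) (ℤ.+-monoˡ-≤ (- i) (ℤ.i<j⇒suc[i]≤j i<j))
  where
  1+i-i≡1 : ∀ i → + 1 + i - i ≡ + 1
  1+i-i≡1 = solve-∀

≤+∣-∣ : ∀ {i j} → i ≤ j → j ≤ i + + ∣ j - i ∣
≤+∣-∣ {i} {j} i≤j =
  ℤ.≤-reflexive (sym (trans (cong (_+_ i) (ℤ.0≤i⇒+∣i∣≡i (ℤ.i≤j⇒0≤j-i i≤j))) (i+[j-i]≡j i j)))

1+i≰i+0 : ∀ i → ¬ (+ 1 + i ≤ i + + 0)
1+i≰i+0 i 1+i≤i = ℤ.<-irrefl refl (ℤ.suc[i]≤j⇒i<j (subst (+ 1 + i ≤_) (ℤ.+-identityʳ i) 1+i≤i))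

≤+suc⇒≤+ : ∀ {u t t′} d → u ≤ t + + suc d → + 1 + t ≤ t′ → u ≤ t′ + + d
≤+suc⇒≤+ {u} {t} {t′} d u≤ 1+t≤t′ =
  ℤ.≤-trans u≤ (subst (_≤ t′ + + d) (sym (shift t (+ d))) (ℤ.+-monoˡ-≤ (+ d) 1+t≤t′))
  where
  shift : ∀ t d → t + (+ 1 + d) ≡ (+ 1 + t) + d
  shift = solve-∀

-- One lifting

NonnegSolvable : ∀ {m n} → Matrix m n → Set
NonnegSolvable A = ∃[ y ] (Nonneg y × IsSolution A y)

raise : ∀ {n} → Subset n → ℤ → Fin (suc n) → ℤ
raise J a c = if J c then a else 0ℤ

module _ {n} (J : Subset n) {a : ℤ} (c : Fin (suc n)) where

  raise-∈ : T (J c) → raise J a c ≡ a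
  raise-∈ Jc with J c
  ... | true = refl

  raise-∉ : ¬ T (J c) → raise J a c ≡ 0ℤ
  raise-∉ ¬Jc with J c
  ... | true  = contradiction tt ¬Jc
  ... | false = refl

  raise-nonneg : 0ℤ ≤ a → 0ℤ ≤ raise J a c
  raise-nonneg 0≤a with J c
  ... | true  = 0≤a
  ... | false = ℤ.≤-refl

module Lifting {m n} (B : Matrix m n) (i : Fin (suc n)) (strict : minPos (B zero) ≡ i ∷ []) where

  open Closure B

  F : Subset n
  F = liftSet B i

  a : ℤ
  a = liftAmount B F

  MinsInF : Fin (suc m) → Set
  MinsInF r = T (minsInJ F (B r))

  MinsInF⇒∈F : ∀ {r k} → MinsInF r → k ∈ minPos (B r) → T (F k)
  MinsInF⇒∈F {r} mins = All.lookup (All.all⁺ F (minPos (B r)) mins)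

  MinsInF-zero : MinsInF zero
  MinsInF-zero = All.all⁻ F (subst (All (T ∘ F)) (sym strict) (liftSet-∋ i All.∷ All.[]))

  Separated : (Fin (suc n) → ℤ) → ℤ → Set
  Separated y v = ∀ r k → MinsInF r → ¬ T (F k) → rowMin (B r) + v < B r k + y k

  module _ {y} (y-sol : IsSolution B y) {v} (v≤y : ∀ j → T (F j) → v ≤ y j) (sep : Separated y v) where

    private
      strict-min-at : ∀ r {j} → j ∈ minPos (B r) → y j ≡ v → MinsInF r →
        (∀ {k} → k ∈ minPos (B r) → k ≢ j → y k ≢ v) → ⊥
      strict-min-at r {j} j∈ yj≡v mins others =
        strictMin⇒¬MinTwice (addCols B y r) j
          (λ k k≢j → subst (_< B r k + y k) (sym (cong₂ _+_ (∈-minPos⁻ (B r) j∈) yj≡v)) (above k k≢j))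
          (y-sol r)
        where
        above : ∀ k → k ≢ j → rowMin (B r) + v < B r k + y k
        above k k≢j with B r k ℤ.≟ rowMin (B r) | T? (F k)
        ... | yes Brk≡min | _ = subst (λ b → rowMin (B r) + v < b + y k) (sym Brk≡min)
          (ℤ.+-monoʳ-< (rowMin (B r))
            (ℤ.≤∧≢⇒< (v≤y k (MinsInF⇒∈F mins k∈)) (others k∈ k≢j ∘ sym)))
          where k∈ = ∈-minPos⁺ (B r) Brk≡min
        ... | no Brk≢min | yes Fk = ℤ.+-mono-<-≤ (ℤ.≤∧≢⇒< (rowMin-≤ (B r) k) (Brk≢min ∘ sym)) (v≤y k Fk)
        ... | no _        | no ¬Fk = sep r k mins ¬Fk

      Avoids : Subset n → Set
      Avoids J = ∀ j → T (J j) → y j ≢ v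

      avoids-singleton : Avoids (singleton i)
      avoids-singleton j ∈i yj≡v with ∈-singleton⁻ {i = i} {j} ∈i
      ... | refl = strict-min-at zero i∈ yj≡v MinsInF-zero
                     (λ k∈ k≢i → contradiction (∈-singleton′ (subst (_ ∈_) strict k∈)) k≢i)
        where
        i∈ = subst (i ∈_) (sym strict) (here refl)
        ∈-singleton′ : ∀ {k} → k ∈ i ∷ [] → k ≡ i
        ∈-singleton′ (here k≡i) = k≡i

      avoids-closeStep : ∀ J → J ⊆ F → closeStep B J ⊆ F → Avoids J → Avoids (closeStep B J)
      avoids-closeStep J J⊆F cJ⊆F avoids j t yj≡v with closeStep⇒ J j t
      ... | inj₁ Jj = avoids j Jj yj≡v
      ... | inj₂ (r , outside≡j) = strict-min-at r j∈ yj≡v mins others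
        where
        j∈ : j ∈ minPos (B r)
        j∈ = proj₁ (∈-notIn⁻ J (subst (j ∈_) (sym outside≡j) (here refl)))
        j-or-J : ∀ {k} → k ∈ minPos (B r) → k ≡ j ⊎ T (J k)
        j-or-J {k} k∈ with T? (J k)
        ... | yes Jk = inj₂ Jk
        ... | no ¬Jk with subst (k ∈_) outside≡j (∈-notIn⁺ J k∈ ¬Jk)
        ...   | here k≡j = inj₁ k≡j
        mins : MinsInF r
        mins = All.all⁻ F (All.tabulate λ k∈ → [ (λ { refl → cJ⊆F j t }) , J⊆F _ ] (j-or-J k∈))
        others : ∀ {k} → k ∈ minPos (B r) → k ≢ j → y k ≢ v
        others k∈ k≢j with j-or-J k∈
        ... | inj₁ k≡j = contradiction k≡j k≢j
        ... | inj₂ Jk  = avoids _ Jk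

    floor-not-attained : ∀ j → T (F j) → y j ≢ v
    floor-not-attained = liftSet-ind i Avoids avoids-singleton avoids-closeStep

  solution-≥ : ∀ {y} → IsSolution B y → Nonneg y →
    ∀ w → (∀ w′ → w′ ℕ.< w → Separated y (+ w′)) → ∀ j → T (F j) → + w ≤ y j
  solution-≥ y-sol y≥0 ℕ.zero    _   j _  = y≥0 j
  solution-≥ y-sol y≥0 (suc w) sep j Fj =
    ℤ.i<j⇒suc[i]≤j (ℤ.≤∧≢⇒< (w≤y j Fj) (floor-not-attained y-sol w≤y (sep w ℕ.≤-refl) j Fj ∘ sym))
    where
    w≤y = solution-≥ y-sol y≥0 w (λ w′ → sep w′ ∘ ℕ.m<n⇒m<1+n)

  liftSet-full⇒unsolvable : allIn F ≡ true → ¬ NonnegSolvable B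
  liftSet-full⇒unsolvable full (y , y≥0 , y-sol) =
    ℕ.<-irrefl refl (ℤ.drop‿+≤+ (subst (+ suc ∣ y i ∣ ≤_) (sym (ℤ.0≤i⇒+∣i∣≡i (y≥0 i))) above))
    where
    ∈F : ∀ k → T (F k)
    ∈F k = All.lookup (All.all⁺ F (allFin _) (Equivalence.from T-≡ full)) (∈-allFin k)
    above : + suc ∣ y i ∣ ≤ y i
    above = solution-≥ y-sol y≥0 (suc ∣ y i ∣) (λ _ _ _ k _ ¬Fk → contradiction (∈F k) ¬Fk) i (liftSet-∋ i)

  module Proper (proper : allIn F ≡ false) where

    private
      outside : List (Fin (suc n))
      outside = notIn F (allFin _)

      minOutside : Fin (suc m) → ℤ
      minOutside r = fromMaybe0 (minList (map (B r) outside))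

      some-outside : ∃ λ k → k ∈ outside
      some-outside =
        let k , _ , ¬Fk = find (All.¬All⇒Any¬ (T? ∘ F) (allFin _) (subst T proper ∘ All.all⁻ F))
        in k , ∈-notIn⁺ F (∈-allFin k) ¬Fk

      rowMin<outside : ∀ {r k} → MinsInF r → ¬ T (F k) → rowMin (B r) < B r k
      rowMin<outside {r} {k} mins ¬Fk =
        ℤ.≤∧≢⇒< (rowMin-≤ (B r) k) (¬Fk ∘ MinsInF⇒∈F mins ∘ ∈-minPos⁺ (B r) ∘ sym)

      gap-positive : ∀ {r} → MinsInF r → + 1 ≤ gap F (B r)
      gap-positive {r} mins = i<j⇒1≤j-i {rowMin (B r)} {minOutside r}
        (ℤ.suc[i]≤j⇒i<j (minList-greatest (∈-map⁺ (B r) (proj₂ some-outside))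
          (All.map⁺ (All.tabulate λ k∈ → ℤ.i<j⇒suc[i]≤j (rowMin<outside mins (proj₂ (∈-notIn⁻ F k∈)))))))

      ∈-MinsInF-rows : ∀ {r} → MinsInF r → r ∈ filter (λ r → T? (minsInJ F (B r))) (allFin _)
      ∈-MinsInF-rows {r} = ∈-filter⁺ (λ r → T? (minsInJ F (B r))) (∈-allFin r)

    a-positive : + 1 ≤ a
    a-positive = minList-greatest (∈-map⁺ _ (∈-MinsInF-rows MinsInF-zero))
      (All.map⁺ (All.tabulate λ r∈ → gap-positive (proj₂ (∈-filter⁻ (λ r → T? (minsInJ F (B r))) r∈))))

    a≤outside : ∀ {r k} → MinsInF r → ¬ T (F k) → rowMin (B r) + a ≤ B r k
    a≤outside {r} {k} mins ¬Fk = begin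
      rowMin (B r) + a             ≤⟨ ℤ.+-monoʳ-≤ (rowMin (B r)) (minList-≤ (∈-map⁺ _ (∈-MinsInF-rows mins))) ⟩
      rowMin (B r) + gap F (B r)   ≡⟨ i+[j-i]≡j (rowMin (B r)) (minOutside r) ⟩
      minOutside r                 ≤⟨ minList-≤ (∈-map⁺ (B r) (∈-notIn⁺ F (∈-allFin k) ¬Fk)) ⟩
      B r k                        ∎
      where open ℤ.≤-Reasoning

    a≥0 : 0ℤ ≤ a
    a≥0 = ℤ.≤-trans (+≤+ ℕ.z≤n) a-positive

    solution-≥-a : ∀ {y} → IsSolution B y → Nonneg y → ∀ j → T (F j) → a ≤ y j
    solution-≥-a {y} y-sol y≥0 = subst (λ b → ∀ j → T (F j) → b ≤ y j) ∣a∣≡a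
      (solution-≥ y-sol y≥0 ∣ a ∣ separated)
      where
      ∣a∣≡a = ℤ.0≤i⇒+∣i∣≡i a≥0
      separated : ∀ w → w ℕ.< ∣ a ∣ → Separated y (+ w)
      separated w w<a r k mins ¬Fk = begin-strict
        rowMin (B r) + + w  <⟨ ℤ.+-monoʳ-< (rowMin (B r)) (subst (+ w <_) ∣a∣≡a (+<+ w<a)) ⟩
        rowMin (B r) + a    ≤⟨ a≤outside mins ¬Fk ⟩
        B r k               ≤⟨ ℤ.i≤i+j (B r k) (y k) {{nonNegative (y≥0 k)}} ⟩
        B r k + y k         ∎
        where open ℤ.≤-Reasoning

    private
      lifted : Row n → Row n
      lifted row c = row c + raise F a c

      min-in-F-stays : ∀ {r p} → MinsInF r → IsMinAt (B r) p → IsMinAt (lifted (B r)) p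
      min-in-F-stays {r} {p} mins p-min = stays
        where
        p≡min = IsMinAt⇒≡rowMin (B r) p-min
        Fp = MinsInF⇒∈F mins (∈-minPos⁺ (B r) p≡min)
        stays : IsMinAt (lifted (B r)) p
        stays k with T? (F k)
        ... | yes Fk = subst₂ (λ s t → B r p + s ≤ B r k + t) (sym (raise-∈ F p Fp)) (sym (raise-∈ F k Fk))
                              (ℤ.+-monoˡ-≤ a (p-min k))
        ... | no ¬Fk = begin
          B r p + raise F a p   ≡⟨ cong₂ _+_ p≡min (raise-∈ F p Fp) ⟩
          rowMin (B r) + a      ≤⟨ a≤outside mins ¬Fk ⟩
          B r k                 ≡⟨ sym (ℤ.+-identityʳ (B r k)) ⟩
          B r k + 0ℤ            ≡⟨ cong (_+_ (B r k)) (sym (raise-∉ F k ¬Fk)) ⟩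
          B r k + raise F a k   ∎
          where open ℤ.≤-Reasoning

      min-outside-F-stays : ∀ {row : Row n} {p} → ¬ T (F p) → IsMinAt row p → IsMinAt (lifted row) p
      min-outside-F-stays {row} {p} ¬Fp p-min k = begin
        row p + raise F a p  ≡⟨ trans (cong (_+_ (row p)) (raise-∉ F p ¬Fp)) (ℤ.+-identityʳ (row p)) ⟩
        row p                ≤⟨ p-min k ⟩
        row k                ≤⟨ ℤ.i≤i+j (row k) (raise F a k) {{nonNegative (raise-nonneg F k a≥0)}} ⟩
        row k + raise F a k  ∎
        where open ℤ.≤-Reasoning

    -- If some minimum of a row lies outside F, then at least two do: a single one
    -- would have been added to the closed set F.
    lifted-MinTwice : ∀ r → MinTwice (B r) → MinTwice (lifted (B r))
    lifted-MinTwice r (p , q , p≢q , p-min , q-min) with T? (minsInJ F (B r))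
    ... | yes mins = p , q , p≢q , min-in-F-stays mins p-min , min-in-F-stays mins q-min
    ... | no ¬mins with notIn F (minPos (B r)) in outside≡ | notIn-unique F (minPos-unique (B r))
    ...   | [] | _ =
      let k , k∈ , ¬Fk = find (All.¬All⇒Any¬ (T? ∘ F) (minPos (B r)) (¬mins ∘ All.all⁻ F))
      in contradiction (subst (k ∈_) outside≡ (∈-notIn⁺ F k∈ ¬Fk)) λ ()
    ...   | k ∷ [] | _ =
      contradiction (liftSet-closed i k (closeStep⇐ F k r outside≡))
                    (proj₂ (∈-notIn⁻ F {minPos (B r)} (subst (k ∈_) (sym outside≡) (here refl))))
    ...   | p′ ∷ q′ ∷ l | (p′≢q′ All.∷ _) ∷ _ =
      p′ , q′ , p′≢q′ , stays (∈-outside (here refl)) , stays (∈-outside (there (here refl)))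
      where
      ∈-outside : ∀ {k} → k ∈ p′ ∷ q′ ∷ l → k ∈ notIn F (minPos (B r))
      ∈-outside = subst (_ ∈_) (sym outside≡)
      stays : ∀ {k} → k ∈ notIn F (minPos (B r)) → IsMinAt (lifted (B r)) k
      stays k∈ = let k∈min , ¬Fk = ∈-notIn⁻ F {minPos (B r)} k∈
                 in min-outside-F-stays ¬Fk (≡rowMin⇒IsMinAt (B r) (∈-minPos⁻ (B r) k∈min))

-- The lifting phase

total : ∀ {n} → (Fin (suc n) → ℤ) → ℤ
total {ℕ.zero} x = x zero
total {suc n}  x = x zero + total (x ∘ suc)

total-mono : ∀ {n} {x x′ : Fin (suc n) → ℤ} → (∀ c → x c ≤ x′ c) → total x ≤ total x′
total-mono {ℕ.zero} x≤x′ = x≤x′ zero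
total-mono {suc n}  x≤x′ = ℤ.+-mono-≤ (x≤x′ zero) (total-mono (x≤x′ ∘ suc))

total-mono-< : ∀ {n} {x x′ : Fin (suc n) → ℤ} → (∀ c → x c ≤ x′ c) →
  ∀ j → x j < x′ j → total x < total x′
total-mono-< {ℕ.zero} _    zero    x<x′ = x<x′
total-mono-< {suc n}  x≤x′ zero    x<x′ = ℤ.+-mono-<-≤ x<x′ (total-mono (x≤x′ ∘ suc))
total-mono-< {suc n}  x≤x′ (suc j) x<x′ = ℤ.+-mono-≤-< (x≤x′ zero) (total-mono-< (x≤x′ ∘ suc) j x<x′)

liftingPhase-stop : ∀ {m n} k {B : Matrix m n} → strictMinCol (B zero) ≡ nothing → liftingPhase k B ≡ output B
liftingPhase-stop k smc rewrite smc = refl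

liftingPhase-lift : ∀ {m n} k {B : Matrix m n} {i} → strictMinCol (B zero) ≡ just i → allIn (liftSet B i) ≡ false →
  liftingPhase (suc k) B ≡ liftingPhase k (λ r c → B r c + raise (liftSet B i) (liftAmount B (liftSet B i)) c)
liftingPhase-lift k smc proper rewrite smc | proper = refl

module Phase {m n} (A : Matrix m n) where

  record Invariant (B : Matrix m n) (x : Fin (suc n) → ℤ) : Set where
    field
      B≡A+x          : ∀ r c → B r c ≡ A r c + x c
      x≥0            : Nonneg x
      tail-MinTwice  : ∀ r → MinTwice (B (suc r))
      x≤solutions    : ∀ y → Nonneg y → IsSolution A y → ∀ c → x c ≤ y c

  invariant₀ : (∀ r → MinTwice (A (suc r))) → Invariant A (λ _ → 0ℤ)
  invariant₀ tail = record
    { B≡A+x         = λ r c → sym (ℤ.+-identityʳ (A r c))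
    ; x≥0           = λ _ → ℤ.≤-refl
    ; tail-MinTwice = tail
    ; x≤solutions   = λ _ y≥0 _ → y≥0
    }

  module _ {B x} (inv : Invariant B x) where

    open Invariant inv

    least-solution : MinTwice (B zero) → IsLeastNonnegSolution A x
    least-solution head = x≥0 , solution , x≤solutions
      where
      solution : IsSolution A x
      solution zero    = MinTwice-cong (B≡A+x zero) head
      solution (suc r) = MinTwice-cong (B≡A+x (suc r)) (tail-MinTwice r)

    shifted-solution : ∀ {y} → Nonneg y → IsSolution A y →
      Nonneg (λ c → y c - x c) × IsSolution B (λ c → y c - x c)
    shifted-solution {y} y≥0 y-sol = (λ c → ℤ.i≤j⇒0≤j-i (x≤solutions y y≥0 y-sol c)) , solution
      where
      shift : ∀ a y x → a + y ≡ (a + x) + (y - x)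
      shift = solve-∀
      solution : IsSolution B (λ c → y c - x c)
      solution r = MinTwice-cong (λ c → trans (shift (A r c) (y c) (x c)) (cong (_+ (y c - x c)) (sym (B≡A+x r c))))
                                 (y-sol r)

    module _ {i} (strict : minPos (B zero) ≡ i ∷ []) where

      open Lifting B i strict

      unsolvable : allIn F ≡ true → ¬ NonnegSolvable A
      unsolvable full (y , y≥0 , y-sol) =
        let d≥0 , d-sol = shifted-solution y≥0 y-sol in liftSet-full⇒unsolvable full (_ , d≥0 , d-sol)

      module _ (proper : allIn F ≡ false) where

        open Proper proper

        x′ : Fin (suc n) → ℤ
        x′ c = x c + raise F a c

        x≤x′ : ∀ c → x c ≤ x′ c
        x≤x′ c = ℤ.i≤i+j (x c) (raise F a c) {{nonNegative (raise-nonneg F c a≥0)}}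

        total-grows : + 1 + total x ≤ total x′
        total-grows = ℤ.i<j⇒suc[i]≤j (total-mono-< x≤x′ i (begin-strict
          x i                  ≡⟨ sym (ℤ.+-identityʳ (x i)) ⟩
          x i + 0ℤ             <⟨ ℤ.+-monoʳ-< (x i) (ℤ.suc[i]≤j⇒i<j a-positive) ⟩
          x i + a              ≡⟨ cong (_+_ (x i)) (sym (raise-∈ F i (Closure.liftSet-∋ B i))) ⟩
          x i + raise F a i    ∎))
          where open ℤ.≤-Reasoning

        lifted-invariant : Invariant (λ r c → B r c + raise F a c) x′
        lifted-invariant = record
          { B≡A+x         = λ r c → trans (cong (_+ raise F a c) (B≡A+x r c)) (ℤ.+-assoc (A r c) (x c) (raise F a c))
          ; x≥0           = λ c → ℤ.+-mono-≤ (x≥0 c) (raise-nonneg F c a≥0)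
          ; tail-MinTwice = λ r → lifted-MinTwice (suc r) (tail-MinTwice r)
          ; x≤solutions   = x′≤solutions
          }
          where
          x′≤solutions : ∀ y → Nonneg y → IsSolution A y → ∀ c → x′ c ≤ y c
          x′≤solutions y y≥0 y-sol c with T? (F c)
          ... | yes Fc = begin
            x c + raise F a c     ≡⟨ cong (_+_ (x c)) (raise-∈ F c Fc) ⟩
            x c + a               ≤⟨ ℤ.+-monoʳ-≤ (x c) (solution-≥-a d-sol d≥0 c Fc) ⟩
            x c + (y c - x c)     ≡⟨ i+[j-i]≡j (x c) (y c) ⟩
            y c                   ∎
            where
            open ℤ.≤-Reasoning
            d≥0 = proj₁ (shifted-solution y≥0 y-sol)
            d-sol = proj₂ (shifted-solution y≥0 y-sol)
          ... | no ¬Fc = begin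
            x c + raise F a c     ≡⟨ trans (cong (_+_ (x c)) (raise-∉ F c ¬Fc)) (ℤ.+-identityʳ (x c)) ⟩
            x c                   ≤⟨ x≤solutions y y≥0 y-sol c ⟩
            y c                   ∎
            where open ℤ.≤-Reasoning

  open Invariant

  output⇒least : ∀ k {B x C} → Invariant B x → liftingPhase k B ≡ output C →
    ∃[ x′ ] (IsLeastNonnegSolution A x′ × (∀ i j → C i j ≡ addCols A x′ i j))
  output⇒least k {B} {x} inv eq with strictMinCol (B zero) in smc | eq
  ... | nothing | refl = x , least-solution inv (strictMinCol≡nothing (B zero) smc) , B≡A+x inv
  output⇒least (suc k) {B} inv eq | just i | eq′ with allIn (liftSet B i) in coverage | eq′
  ... | false | eq″ = output⇒least k (lifted-invariant inv (strictMinCol≡just (B zero) smc) coverage) eq″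

  infeasible⇒unsolvable : ∀ k {B x} → Invariant B x → liftingPhase k B ≡ infeasible → ¬ NonnegSolvable A
  infeasible⇒unsolvable k {B} inv eq with strictMinCol (B zero) in smc | eq
  infeasible⇒unsolvable (suc k) {B} inv eq | just i | eq′ with allIn (liftSet B i) in coverage | eq′
  ... | true  | _   = unsolvable inv (strictMinCol≡just (B zero) smc) coverage
  ... | false | eq″ = infeasible⇒unsolvable k (lifted-invariant inv (strictMinCol≡just (B zero) smc) coverage) eq″

  -- The fuel d bounds the number of remaining liftings, since each one raises
  -- total x by at least 1 while keeping x below the solution y.
  solvable⇒output : ∀ {y} → Nonneg y → IsSolution A y →
    ∀ d {B x} → Invariant B x → total y ≤ total x + + d → ∃[ k ] ∃[ C ] (liftingPhase k B ≡ output C)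
  solvable⇒output {y} y≥0 y-sol d {B} {x} inv bound = go (strictMinCol (B zero)) refl d bound
    where
    go : ∀ s → strictMinCol (B zero) ≡ s → ∀ d → total y ≤ total x + + d →
      ∃[ k ] ∃[ C ] (liftingPhase k B ≡ output C)
    go nothing  smc _ _ = 0 , B , liftingPhase-stop 0 smc
    go (just i) smc d bound with strictMinCol≡just (B zero) smc | allIn (liftSet B i) in coverage
    ... | strict | true  = contradiction (y , y≥0 , y-sol) (unsolvable inv strict coverage)
    ... | strict | false with d
    ...   | ℕ.zero =
      contradiction (ℤ.≤-trans (ℤ.≤-trans (total-grows inv strict coverage) x′≤y) bound) (1+i≰i+0 (total x))
      where x′≤y = total-mono (x≤solutions (lifted-invariant inv strict coverage) y y≥0 y-sol)
    ...   | suc d′ =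
      let k , C , run = solvable⇒output y≥0 y-sol d′ (lifted-invariant inv strict coverage)
                          (≤+suc⇒≤+ {t = total x} d′ bound (total-grows inv strict coverage))
      in suc k , C , trans (liftingPhase-lift k {B} smc coverage) run

theorem1 : ∀ {m n} (A : Matrix m n) →
    (∀ (i : Fin m) → MinTwice (A (suc i))) →
    ((∀ k B → liftingPhase k A ≡ output B →
        ∃[ x ] (IsLeastNonnegSolution A x × (∀ i j → B i j ≡ addCols A x i j)))
    × (∀ k → liftingPhase k A ≡ infeasible →
        ¬ (∃[ y ] (Nonneg y × IsSolution A y)))
    × ((∃[ y ] (Nonneg y × IsSolution A y)) →
        ∃[ k ] ∃[ B ] (liftingPhase k A ≡ output B)))
theorem1 A tail =
    (λ k _ → output⇒least k inv₀)
  , (λ k → infeasible⇒unsolvable k inv₀)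
  , λ (y , y≥0 , y-sol) → solvable⇒output y≥0 y-sol _ inv₀ (≤+∣-∣ (total-mono y≥0))
  where
  open Phase A
  inv₀ = invariant₀ tail
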